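{- Let $\mathcal{A},\mathcal{B}$ be finite alphabets, $r\geq1$, $\mathbf{u}$ an infinite word over $\mathcal{A}$ which is stable by reflection, and $F$ a stable cellular automaton associated with a map $\mathcal{A}^r\to\mathcal{B}$ which is injective on the set of factors of $\mathbf{u}$ of length at least $r$. Then $F(\mathbf{u})$ is rich if and only if $\mathbf{u}$ is rich.
   Context: The cellular automaton $F$ associated with $f:\mathcal{A}^r\to\mathcal{B}$ maps an infinite word $u_0u_1\cdots$ to the infinite word whose $i$-th letter is $f(u_i\cdots u_{i+r-1})$, and a finite word $w_0\cdots w_{m-1}$ ($m\geq r$) to $f(w_0\cdots w_{r-1})\cdots f(w_{m-r}\cdots w_{m-1})$ (to $\varepsilon$ if $m<r$). For $w=w_1\cdots w_n$, $\overline{w}=w_n\cdots w_1$; $w$ is a palindrome if $\overline{w}=w$. $F$ is stable if $F(\overline{w})=F(w)$ for all $w\in\mathcal{A}^r$. An infinite word is stable by reflection if the reflection of each of its factors is also a factor. An infinite word is rich if every factor $w$ of it has exactly $|w|+1$ distinct palindromic factors, counting the empty word. -}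

module Defs where

open import Data.Nat using (ℕ; zero; suc; _+_; _≤_)
open import Data.Fin using (Fin; toℕ)
open import Data.List as L using (List; []; _∷_; _++_; length; map; upTo)
open import Data.List.Membership.Propositional using (_∈_)
open import Data.List.Relation.Unary.Unique.Propositional using (Unique)
open import Data.Vec as V using (Vec; tabulate)
open import Data.Maybe using (Maybe; just; nothing)
open import Data.Product using (Σ; ∃; ∃-syntax; _×_; _,_)
open import Function.Bundles using (_⇔_)
open import Relation.Binary.PropositionalEquality using (_≡_)

InfWord : Set → Set
InfWord A = ℕ → A

slice : {A : Set} → InfWord A → ℕ → ℕ → List A
slice u i n = map (λ j → u (i + j)) (upTo n)

FactorInf : {A : Set} → List A → InfWord A → Set
FactorInf v u = ∃[ i ] slice u i (length v) ≡ v

Factor : {A : Set} → List A → List A → Set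
Factor v w = ∃[ p ] ∃[ s ] p ++ v ++ s ≡ w

Palindrome : {A : Set} → List A → Set
Palindrome w = L.reverse w ≡ w

HasCard : {A : Set} → (List A → Set) → ℕ → Set
HasCard {A} P n = Σ (List (List A)) λ Ls →
  Unique Ls × (∀ v → (v ∈ Ls) ⇔ P v) × length Ls ≡ n

-- w has exactly |w|+1 distinct palindromic factors (the empty word included).
RichWord : {A : Set} → List A → Set
RichWord w = HasCard (λ v → Factor v w × Palindrome v) (suc (length w))

Rich : {A : Set} → InfWord A → Set
Rich u = ∀ w → FactorInf w u → RichWord w

StableByReflection : {A : Set} → InfWord A → Set
StableByReflection u = ∀ w → FactorInf w u → FactorInf (L.reverse w) u

takeVec : {A : Set} (r : ℕ) → List A → Maybe (Vec A r)
takeVec zero _ = just V.[]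
takeVec (suc r) [] = nothing
takeVec (suc r) (x ∷ xs) with takeVec r xs
... | just v = just (x V.∷ v)
... | nothing = nothing

-- Cellular automaton on finite words (ε if the word is shorter than r).
CAfin : {A B : Set} {r : ℕ} → (Vec A r → B) → List A → List B
CAfin f [] = []
CAfin {r = r} f (x ∷ xs) with takeVec r (x ∷ xs)
... | just v = f v ∷ CAfin f xs
... | nothing = []

CAinf : {A B : Set} {r : ℕ} → (Vec A r → B) → InfWord A → InfWord B
CAinf {r = r} f u i = f (tabulate λ k → u (i + toℕ k))

StableCA : {A B : Set} {r : ℕ} → (Vec A r → B) → Set
StableCA {A} {r = r} f = (w : Vec A r) → f (V.reverse w) ≡ f w

InjectiveOnFactors : {A B : Set} {r : ℕ} → (Vec A r → B) → InfWord A → Set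
InjectiveOnFactors {r = r} f u = ∀ w w' → FactorInf w u → FactorInf w' u →
  r ≤ length w → r ≤ length w' → CAfin f w ≡ CAfin f w' → w ≡ w'

module Submission where

-- For r = 1, F(u) is the image of u under a letter-to-letter coding that is injective on the
-- letters of u; such a coding maps the palindromic factors of each factor of u bijectively onto
-- those of its image, so it preserves and reflects richness. For r ≥ 2, a factor of length r and
-- its reflection (again a factor of u) have the same image under the stable F, so injectivity
-- makes every factor of length r a palindrome. Comparing the ends of two overlapping such
-- palindromes shows that u has period 2; then so has F(u), which is again an injective coding of u.

open import Defs
open import Data.Nat using (ℕ; zero; suc; _+_; _≤_; _<_; s≤s)
open import Data.Nat.Properties using (+-identityʳ; +-suc; +-comm; +-assoc; ≤-reflexive)
open import Data.Empty using (⊥-elim)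
open import Data.Fin using (Fin; toℕ; _≟_)
open import Data.List as L using (List; []; _∷_; _++_; length; map; applyUpTo)
open import Data.List.Properties
  using (map-++; length-map; reverse-map; reverse-applyUpTo; map-upTo; map-cong; map-∘;
         length-applyUpTo; ∷-injectiveˡ; ∷-injectiveʳ; ∷-injective; length-reverse)
open import Data.List.Membership.Propositional using (_∈_)
open import Data.List.Membership.Propositional.Properties using (∈-map⁺; ∈-map⁻)
open import Data.List.Relation.Unary.All as All using (All; []; _∷_)
import Data.List.Relation.Unary.All.Properties as All
import Data.List.Relation.Unary.Any.Properties as Any
open import Data.List.Relation.Unary.AllPairs using ([]; _∷_)
open import Data.List.Relation.Unary.Unique.Propositional using (Unique)
import Data.List.Relation.Unary.Unique.Propositional.Properties as Unique
open import Data.Maybe using (just; nothing)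
open import Data.Product using (∃-syntax; Σ-syntax; _×_; _,_; proj₁; proj₂)
open import Data.Sum using (_⊎_; inj₁; inj₂)
open import Data.Vec as V using (Vec; tabulate)
open import Data.Vec.Properties using (toList-injective; toList-reverse; tabulate-cong)
open import Data.Vec.Relation.Binary.Equality.Cast using (cast-is-id)
open import Function using (_∘_)
open import Function.Bundles using (_⇔_; mk⇔; Equivalence)
open import Function.Properties.Equivalence using () renaming (sym to ⇔-sym)
open import Relation.Binary.Definitions using (DecidableEquality)
open import Relation.Binary.PropositionalEquality
open import Relation.Nullary using (yes; no)

module _ {A B : Set} {P : List A → Set} {Q : List B → Set} (h : List A → List B)
         (injectiveOn : ∀ {x y} → P x → P y → h x ≡ h y → x ≡ y)
         (preserves : ∀ {x} → P x → Q (h x))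
         (covers : ∀ {y} → Q y → ∃[ x ] P x × h x ≡ y) where

  private
    Unique-map : ∀ {xs} → All P xs → Unique xs → Unique (map h xs)
    Unique-map [] [] = []
    Unique-map (px ∷ pxs) (x∉ ∷ uniq) =
      All.map⁺ (All.zipWith (λ (x≢y , py) hx≡hy → x≢y (injectiveOn px py hx≡hy)) (x∉ , pxs))
        ∷ Unique-map pxs uniq

    pullback : ∀ {ys} → All Q ys → ∃[ xs ] All P xs × map h xs ≡ ys
    pullback [] = [] , [] , refl
    pullback (qy ∷ qys) with covers qy | pullback qys
    ... | x , px , refl | xs , pxs , refl = x ∷ xs , px ∷ pxs , refl

    HasCard-image : ∀ {n} → HasCard P n → HasCard Q n
    HasCard-image (xs , uniq , mem , len) =
      map h xs , Unique-map pxs uniq , (λ y → mk⇔ member⇒Q Q⇒member) , trans (length-map h xs) len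
      where
      pxs : All P xs
      pxs = All.tabulate (Equivalence.to (mem _))
      member⇒Q : ∀ {y} → y ∈ map h xs → Q y
      member⇒Q y∈ with ∈-map⁻ h y∈
      ... | x , x∈ , refl = preserves (All.lookup pxs x∈)
      Q⇒member : ∀ {y} → Q y → y ∈ map h xs
      Q⇒member qy with covers qy
      ... | x , px , refl = ∈-map⁺ h (Equivalence.from (mem x) px)

    HasCard-preimage : ∀ {n} → HasCard Q n → HasCard P n
    HasCard-preimage (ys , uniq , mem , len) with pullback (All.tabulate (Equivalence.to (mem _)))
    ... | xs , pxs , refl =
      xs , Unique.map⁻ uniq , (λ x → mk⇔ (All.lookup pxs) P⇒member) , trans (sym (length-map h xs)) len
      where
      P⇒member : ∀ {x} → P x → x ∈ xs
      P⇒member {x} px with ∈-map⁻ h (Equivalence.from (mem (h x)) (preserves px))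
      ... | x' , x'∈ , hx≡hx' = subst (_∈ xs) (sym (injectiveOn px (All.lookup pxs x'∈) hx≡hx')) x'∈

  HasCard-correspondence : ∀ {n} → HasCard P n ⇔ HasCard Q n
  HasCard-correspondence = mk⇔ HasCard-image HasCard-preimage

All-reverse : {A : Set} {S : A → Set} {xs : List A} → All S xs → All S (L.reverse xs)
All-reverse sxs = All.tabulate (All.lookup sxs ∘ Any.reverse⁻)

All-Factor : {A : Set} {S : A → Set} {v w : List A} → Factor v w → All S w → All S v
All-Factor {v = v} (p , s , refl) sw = All.++⁻ˡ v (All.++⁻ʳ p sw)

map-++⁻ : {A B : Set} (g : A → B) (w : List A) {p q : List B} → map g w ≡ p ++ q →
  ∃[ w₁ ] ∃[ w₂ ] w ≡ w₁ ++ w₂ × map g w₁ ≡ p × map g w₂ ≡ q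
map-++⁻ g w {[]} eq = [] , w , refl , refl , eq
map-++⁻ g (c ∷ w) {_ ∷ p} eq with map-++⁻ g w {p} (∷-injectiveʳ eq)
... | w₁ , w₂ , refl , refl , refl = c ∷ w₁ , w₂ , refl , cong (_∷ _) (∷-injectiveˡ eq) , refl

Factor-map : {A B : Set} (g : A → B) {v w : List A} → Factor v w → Factor (map g v) (map g w)
Factor-map g {v} (p , s , refl) = map g p , map g s , (begin
  map g p ++ map g v ++ map g s ≡⟨ cong (map g p ++_) (map-++ g v s) ⟨
  map g p ++ map g (v ++ s)     ≡⟨ map-++ g p (v ++ s) ⟨
  map g (p ++ v ++ s)           ∎)
  where open ≡-Reasoning

Factor-map⁻ : {A B : Set} (g : A → B) {v′ : List B} {w : List A} → Factor v′ (map g w) →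
  ∃[ v ] Factor v w × map g v ≡ v′
Factor-map⁻ g {v′} {w} (p , s , eq) with map-++⁻ g w {p} (sym eq)
... | w₁ , w₂ , refl , _ , eq₂ with map-++⁻ g w₂ {v′} eq₂
... | v , w₃ , refl , refl , _ = v , (w₁ , w₃ , refl) , refl

Palindrome-map : {A B : Set} (g : A → B) {v : List A} → Palindrome v → Palindrome (map g v)
Palindrome-map g {v} pal = trans (sym (reverse-map g v)) (cong (map g) pal)

PalindromicFactorOf : {A : Set} → List A → List A → Set
PalindromicFactorOf w v = Factor v w × Palindrome v

module _ {A B : Set} (g : A → B) (S : A → Set)
         (injectiveOn : ∀ {c d} → S c → S d → g c ≡ g d → c ≡ d) where

  map-injectiveOn : ∀ {xs ys} → All S xs → All S ys → map g xs ≡ map g ys → xs ≡ ys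
  map-injectiveOn [] [] _ = refl
  map-injectiveOn (sx ∷ sxs) (sy ∷ sys) eq =
    cong₂ _∷_ (injectiveOn sx sy (∷-injectiveˡ eq)) (map-injectiveOn sxs sys (∷-injectiveʳ eq))

  Palindrome-map⁻ : ∀ {v} → All S v → Palindrome (map g v) → Palindrome v
  Palindrome-map⁻ {v} sv pal = map-injectiveOn (All-reverse sv) sv (trans (reverse-map g v) pal)

  RichWord-map : ∀ {w} → All S w → RichWord (map g w) ⇔ RichWord w
  RichWord-map {w} sw = subst (λ n → HasCard (PalindromicFactorOf (map g w)) (suc n) ⇔ RichWord w)
    (sym (length-map g w))
    (⇔-sym (HasCard-correspondence (map g) injective preserves covers))
    where
    injective : ∀ {x y} → PalindromicFactorOf w x → PalindromicFactorOf w y → map g x ≡ map g y → x ≡ y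
    injective (fx , _) (fy , _) = map-injectiveOn (All-Factor fx sw) (All-Factor fy sw)
    preserves : ∀ {x} → PalindromicFactorOf w x → PalindromicFactorOf (map g w) (map g x)
    preserves (fx , px) = Factor-map g fx , Palindrome-map g px
    covers : ∀ {y} → PalindromicFactorOf (map g w) y → ∃[ x ] (PalindromicFactorOf w x) × map g x ≡ y
    covers (fy , py) with Factor-map⁻ g fy
    ... | x , fx , refl = x , (fx , Palindrome-map⁻ (All-Factor fx sw) py) , refl

module _ {A : Set} (u : InfWord A) where

  slice-applyUpTo : ∀ i n → slice u i n ≡ applyUpTo (λ j → u (i + j)) n
  slice-applyUpTo i = map-upTo (λ j → u (i + j))

  length-slice : ∀ i n → length (slice u i n) ≡ n
  length-slice i n = trans (cong length (slice-applyUpTo i n)) (length-applyUpTo _ n)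

  slice-factor : ∀ i n → FactorInf (slice u i n) u
  slice-factor i n = i , cong (slice u i) (length-slice i n)

  slice-letters : ∀ i n → All (λ c → ∃[ k ] u k ≡ c) (slice u i n)
  slice-letters i n = All.map⁺ (All.universal (λ j → i + j , refl) _)

  map-slice : {B : Set} (g : A → B) {v : InfWord B} → (∀ i → v i ≡ g (u i)) →
    ∀ i n → map g (slice u i n) ≡ slice v i n
  map-slice g v≗gu i n = trans (sym (map-∘ _)) (map-cong (λ j → sym (v≗gu (i + j))) _)

Rich-map : {A B : Set} (g : A → B) (u : InfWord A) (v : InfWord B) → (∀ i → v i ≡ g (u i)) →
  (∀ i j → v i ≡ v j → u i ≡ u j) → Rich v ⇔ Rich u
Rich-map {A} g u v v≗gu v-injective = mk⇔ to from
  where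
  Letter : A → Set
  Letter c = ∃[ k ] u k ≡ c
  injectiveOn : ∀ {c d} → Letter c → Letter d → g c ≡ g d → c ≡ d
  injectiveOn (i , refl) (j , refl) eq = v-injective i j (trans (v≗gu i) (trans eq (sym (v≗gu j))))
  RichWord-slice : ∀ i n → RichWord (slice v i n) ⇔ RichWord (slice u i n)
  RichWord-slice i n = subst (λ w → RichWord w ⇔ _) (map-slice u g v≗gu i n)
    (RichWord-map g Letter injectiveOn (slice-letters u i n))
  to : Rich v → Rich u
  to rich-v w (i , slice≡w) =
    subst RichWord slice≡w (Equivalence.to (RichWord-slice i _) (rich-v _ (slice-factor v i _)))
  from : Rich u → Rich v
  from rich-u w (i , slice≡w) =
    subst RichWord slice≡w (Equivalence.from (RichWord-slice i _) (rich-u _ (slice-factor u i _)))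

toList-tabulate-toℕ : {A : Set} (h : ℕ → A) (n : ℕ) → V.toList (tabulate {n = n} (h ∘ toℕ)) ≡ applyUpTo h n
toList-tabulate-toℕ h zero = refl
toList-tabulate-toℕ h (suc n) = cong (h 0 ∷_) (toList-tabulate-toℕ (h ∘ suc) n)

takeVec-applyUpTo : {A : Set} (h : ℕ → A) (n : ℕ) → takeVec n (applyUpTo h n) ≡ just (tabulate (h ∘ toℕ))
takeVec-applyUpTo h zero = refl
takeVec-applyUpTo h (suc n) rewrite takeVec-applyUpTo (h ∘ suc) n = refl

takeVec-short : {A : Set} (r : ℕ) (xs : List A) → length xs < r → takeVec r xs ≡ nothing
takeVec-short (suc r) [] _ = refl
takeVec-short (suc r) (x ∷ xs) (s≤s |xs|<r) rewrite takeVec-short r xs |xs|<r = refl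

window : {A : Set} {n : ℕ} → InfWord A → ℕ → Vec A n
window u i = tabulate (λ k → u (i + toℕ k))

toList-window : {A : Set} (u : InfWord A) (i n : ℕ) → V.toList (window {n = n} u i) ≡ slice u i n
toList-window u i n = trans (toList-tabulate-toℕ (λ j → u (i + j)) n) (sym (slice-applyUpTo u i n))

module _ {A B : Set} {r : ℕ} (f : Vec A r → B) where

  CAfin-short : (xs : List A) → length xs < r → CAfin f xs ≡ []
  CAfin-short [] _ = refl
  CAfin-short (x ∷ xs) |xs|<r rewrite takeVec-short r (x ∷ xs) |xs|<r = refl

module _ {A B : Set} {r : ℕ} (f : Vec A (suc r) → B) where

  CAfin-applyUpTo : (h : ℕ → A) → CAfin f (applyUpTo h (suc r)) ≡ f (tabulate (h ∘ toℕ)) ∷ []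
  CAfin-applyUpTo h rewrite takeVec-applyUpTo h (suc r) =
    cong (_ ∷_) (CAfin-short f (applyUpTo (h ∘ suc) r) (s≤s (≤-reflexive (length-applyUpTo _ r))))

  CAfin-slice : (u : InfWord A) (i : ℕ) → CAfin f (slice u i (suc r)) ≡ CAinf f u i ∷ []
  CAfin-slice u i =
    trans (cong (CAfin f) (slice-applyUpTo u i (suc r))) (CAfin-applyUpTo (λ j → u (i + j)))

  module _ (u : InfWord A) (injective : InjectiveOnFactors f u) where

    CAinf-injective-windows : ∀ i j → CAinf f u i ≡ CAinf f u j → slice u i (suc r) ≡ slice u j (suc r)
    CAinf-injective-windows i j eq = injective _ _ (slice-factor u i _) (slice-factor u j _)
      (≤-reflexive (sym (length-slice u i _))) (≤-reflexive (sym (length-slice u j _)))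
      (trans (CAfin-slice u i) (trans (cong (_∷ []) eq) (sym (CAfin-slice u j))))

    CAinf-injective-letters : ∀ i j → CAinf f u i ≡ CAinf f u j → u i ≡ u j
    CAinf-injective-letters i j eq = subst₂ (λ k l → u k ≡ u l) (+-identityʳ i) (+-identityʳ j)
      (∷-injectiveˡ (CAinf-injective-windows i j eq))

    windows-palindromic : StableByReflection u → StableCA f → ∀ i → Palindrome (slice u i (suc r))
    windows-palindromic reflective stable i with reflective _ (slice-factor u i (suc r))
    ... | j , eq = trans (sym slice-j) (CAinf-injective-windows j i (trans (cong f window-j) (stable _)))
      where
      open ≡-Reasoning
      w = slice u i (suc r)
      slice-j : slice u j (suc r) ≡ L.reverse w
      slice-j = trans (cong (slice u j) (sym (trans (length-reverse w) (length-slice u i _)))) eq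
      window-j : window u j ≡ V.reverse (window {n = suc r} u i)
      window-j = trans (sym (cast-is-id refl _)) (toList-injective refl _ _ (begin
        V.toList (window u j)                         ≡⟨ toList-window u j (suc r) ⟩
        slice u j (suc r)                             ≡⟨ slice-j ⟩
        L.reverse w                                   ≡⟨ cong L.reverse (toList-window u i (suc r)) ⟨
        L.reverse (V.toList (window {n = suc r} u i)) ≡⟨ toList-reverse (window u i) ⟨
        V.toList (V.reverse (window u i))             ∎))

Periodic : {A : Set} → ℕ → InfWord A → Set
Periodic p u = ∀ i → u (p + i) ≡ u i

palindrome-ends : {A : Set} (h : ℕ → A) (q : ℕ) → Palindrome (applyUpTo h (2 + q)) →
  h (suc q) ≡ h 0 × h q ≡ h 1
palindrome-ends h q pal with ∷-injective (trans (sym (reverse-applyUpTo h (2 + q))) pal)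
... | last≡first , rest = last≡first , ∷-injectiveˡ rest

module _ {A : Set} {u : InfWord A} where

  palindromic-windows⇒Periodic2 : (q : ℕ) → (∀ i → Palindrome (slice u i (2 + q))) → Periodic 2 u
  palindromic-windows⇒Periodic2 q pal i = begin
    u (2 + i)         ≡⟨ cong (u ∘ suc) (+-comm 1 i) ⟩
    u (suc i + 1)     ≡⟨ proj₂ (ends (suc i)) ⟨
    u (suc i + q)     ≡⟨ cong u (+-suc i q) ⟨
    u (i + suc q)     ≡⟨ proj₁ (ends i) ⟩
    u (i + 0)         ≡⟨ cong u (+-identityʳ i) ⟩
    u i               ∎
    where
    open ≡-Reasoning
    ends : ∀ k → u (k + suc q) ≡ u (k + 0) × u (k + q) ≡ u (k + 1)
    ends k = palindrome-ends (λ j → u (k + j)) q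
      (subst Palindrome (slice-applyUpTo u k (2 + q)) (pal k))

  Periodic2⇒Periodic1 : Periodic 2 u → u 1 ≡ u 0 → Periodic 1 u
  Periodic2⇒Periodic1 per₂ u₁≡u₀ zero = u₁≡u₀
  Periodic2⇒Periodic1 per₂ u₁≡u₀ (suc i) = trans (per₂ i) (sym (Periodic2⇒Periodic1 per₂ u₁≡u₀ i))

  Periodic2-values : Periodic 2 u → ∀ i → u i ≡ u 0 ⊎ u i ≡ u 1
  Periodic2-values per₂ zero = inj₁ refl
  Periodic2-values per₂ (suc zero) = inj₂ refl
  Periodic2-values per₂ (suc (suc i)) with Periodic2-values per₂ i
  ... | inj₁ uᵢ≡u₀ = inj₁ (trans (per₂ i) uᵢ≡u₀)
  ... | inj₂ uᵢ≡u₁ = inj₂ (trans (per₂ i) uᵢ≡u₁)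

CAinf-Periodic : {A B : Set} {r : ℕ} (f : Vec A r → B) {u : InfWord A} (p : ℕ) →
  Periodic p u → Periodic p (CAinf f u)
CAinf-Periodic f {u} p per i =
  cong f (tabulate-cong (λ k → trans (cong u (+-assoc p i (toℕ k))) (per (i + toℕ k))))

Periodic2-letterMap : {A B : Set} → DecidableEquality A → {u : InfWord A} {v : InfWord B} →
  Periodic 2 u → Periodic 2 v → (u 1 ≡ u 0 → v 1 ≡ v 0) → Σ[ g ∈ (A → B) ] (∀ i → v i ≡ g (u i))
Periodic2-letterMap {A} {B} _≟_ {u} {v} per-u per-v agree = g , v≗gu
  where
  g : A → B
  g c with c ≟ u 0
  ... | yes _ = v 0
  ... | no _ = v 1
  uv : InfWord (A × B)
  uv i = u i , v i
  v≗gu : ∀ i → v i ≡ g (u i)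
  v≗gu i with Periodic2-values {u = uv} (λ j → cong₂ _,_ (per-u j) (per-v j)) i | u i ≟ u 0
  ... | inj₁ uvᵢ≡uv₀ | yes _ = cong proj₂ uvᵢ≡uv₀
  ... | inj₁ uvᵢ≡uv₀ | no uᵢ≢u₀ = ⊥-elim (uᵢ≢u₀ (cong proj₁ uvᵢ≡uv₀))
  ... | inj₂ uvᵢ≡uv₁ | yes uᵢ≡u₀ =
    trans (cong proj₂ uvᵢ≡uv₁) (agree (trans (sym (cong proj₁ uvᵢ≡uv₁)) uᵢ≡u₀))
  ... | inj₂ uvᵢ≡uv₁ | no _ = cong proj₂ uvᵢ≡uv₁

CAinf-letterMap : {A B : Set} → DecidableEquality A → (r : ℕ) (f : Vec A (suc r) → B) (u : InfWord A) →
  StableByReflection u → StableCA f → InjectiveOnFactors f u →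
  Σ[ g ∈ (A → B) ] (∀ i → CAinf f u i ≡ g (u i))
CAinf-letterMap _ zero f u _ _ _ = g , λ i → cong (g ∘ u) (+-identityʳ i)
  where
  g = λ c → f (c V.∷ V.[])
CAinf-letterMap _≟_ (suc q) f u reflective stable injective =
  Periodic2-letterMap _≟_ per-u (CAinf-Periodic f 2 per-u)
    (λ u₁≡u₀ → CAinf-Periodic f 1 (Periodic2⇒Periodic1 per-u u₁≡u₀) 0)
  where
  per-u : Periodic 2 u
  per-u = palindromic-windows⇒Periodic2 q (windows-palindromic f u injective reflective stable)

theorem4p11 : (a b r : ℕ) → 1 ≤ r → (u : InfWord (Fin a)) → StableByReflection u →
    (f : Vec (Fin a) r → Fin b) → StableCA f → InjectiveOnFactors f u →
    Rich (CAinf f u) ⇔ Rich u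
theorem4p11 a b (suc r) _ u reflective f stable injective
  with CAinf-letterMap _≟_ r f u reflective stable injective
... | g , F≗gu = Rich-map g u (CAinf f u) F≗gu (CAinf-injective-letters f u injective)
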